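{- Let $n\ge 1$ and $0\le k\le n$. The cyclic $(n,k)$-matrix $M_{n,k}$ is $k$-uniform and optimal (i.e. the cyclic scheme $S_{n,k}$ is optimal).
   Context: Indices run from $0$ to $n-1$. The cyclic $(n,k)$-matrix $M_{n,k}=(m_{i,j})_{0\le i,j\le n-1}$ has $m_{i,j}=1$ iff $j\equiv ik+a \pmod n$ for some $0\le a\le k-1$, and $m_{i,j}=0$ otherwise (traveller $t_i$ cycles the $k$ cyclically consecutive stages from post $P_{ik}$ to $P_{(i+1)k}$, indices mod $n$). Biker–hiker model: $n$ travellers $t_0,\dots,t_{n-1}$; posts $P_0,\dots,P_n$ at unit spacing; stage $s_j$ is the leg from $P_j$ to $P_{j+1}$ ($0\le j\le n-1$). All start at $P_0$ at time $0$, walk at common speed $w$, cycle at common speed $v>w$, mode changes take no time. An $n\times n$ binary matrix $M$ prescribes that $t_i$ cycles $s_j$ iff $m_{i,j}=1$. $M$ is $k$-uniform if every row and every column has exactly $k$ ones. Bicycles start at $P_0$, move only when ridden by one rider, and a traveller due to cycle $s_j$ must take a bicycle present at $P_j$ when he arrives there. $M$ is optimal if it is $k$-uniform for some $k$ and, with $k$ bicycles, the scheme can be executed with no traveller ever having to wait for a bicycle.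
   Formalization: The walking speed $w$ and the cycling speed $v$ are rational, and they are represented by their reciprocals, the times needed per unit stage. -}

module Defs where

open import Data.Bool using (Bool; true; false; if_then_else_)
open import Data.Nat using (ℕ; zero; suc; _+_; _*_; _%_; _<_; _≡ᵇ_; _<ᵇ_)
open import Data.Fin using (Fin; toℕ)
open import Data.List using (List; foldr; upTo; allFin)
open import Data.Bool.ListAction using (any)
open import Data.Rational using (ℚ; 0ℚ) renaming (_+_ to _+ℚ_; _≤_ to _≤ℚ_)
open import Data.Product using (Σ; ∃; _×_)
open import Relation.Binary.PropositionalEquality using (_≡_)

-- A binary n×n matrix: M i j = true means traveller t_i cycles stage s_j.
Matrix : ℕ → Set
Matrix n = Fin n → Fin n → Bool

cyclicMatrix : (n : ℕ) → .{{_ : Data.Nat.NonZero n}} → ℕ → Matrix n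
cyclicMatrix n k i j =
  any (λ a → toℕ j ≡ᵇ ((toℕ i * k + a) % n)) (upTo k)

ones : {n : ℕ} → (Fin n → Bool) → ℕ
ones {n} f = foldr (λ j acc → (if f j then 1 else 0) + acc) 0 (allFin n)

Uniform : {n : ℕ} → ℕ → Matrix n → Set
Uniform {n} k M =
  ((i : Fin n) → ones (λ j → M i j) ≡ k) × ((j : Fin n) → ones (λ i → M i j) ≡ k)

-- Time model via paces (time per unit distance): walking pace a = 1/w,
-- cycling pace b = 1/v; v > w corresponds to 0 < b < a.
stageTime : {n : ℕ} → ℚ → ℚ → Matrix n → Fin n → Fin n → ℚ
stageTime a b M i s = if M i s then b else a

-- Arrival time of traveller t_i at post P_m (no waiting): sum of the
-- times of stages s_0, ..., s_{m-1}.
arrival : {n : ℕ} → ℚ → ℚ → Matrix n → Fin n → ℕ → ℚ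
arrival {n} a b M i m =
  foldr (λ s acc → (if toℕ s <ᵇ m then stageTime a b M i s else 0ℚ) +ℚ acc)
        0ℚ (allFin n)

-- The scheme M can be executed with K bicycles and no waiting:
-- there is an assignment of a bicycle to each (traveller, stage) ride such that
--  * a bicycle is ridden on a given stage by at most one traveller
--    (bicycles only move forward, so they cannot traverse a stage twice);
--  * if t_i rides bicycle β on stage s_j with j ≥ 1, then β was brought to
--    P_j by some traveller riding s_{j-1} who arrived at P_j no later than t_i
--    (all K bicycles are at P_0 at time 0, when every traveller is there).
NoWaitExecutable : {n : ℕ} → ℚ → ℚ → ℕ → Matrix n → Set
NoWaitExecutable {n} a b K M =
  Σ ((i j : Fin n) → M i j ≡ true → Fin K) λ bike →
    ((i i' j : Fin n) (p : M i j ≡ true) (p' : M i' j ≡ true) →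
        bike i j p ≡ bike i' j p' → i ≡ i')
    × ((i : Fin n) (j j' : Fin n) → toℕ j ≡ suc (toℕ j') → (p : M i j ≡ true) →
        ∃ λ i' → Σ (M i' j' ≡ true) λ p' →
          (bike i' j' p' ≡ bike i j p)
          × (arrival a b M i' (toℕ j) ≤ℚ arrival a b M i (toℕ j)))

Optimal : {n : ℕ} → ℚ → ℚ → Matrix n → Set
Optimal a b M = ∃ λ k → Uniform k M × NoWaitExecutable a b k M

-- Lay the n·k rides of the scheme end to end: traveller t_i's rides are the positions
-- p = ik, …, ik + k − 1, position p is stage p mod n, and it is ridden on bicycle ⌊p/n⌋.
-- Each bicycle thus covers the stages 0, …, n − 1 in order, and on stage j ≥ 1 it is
-- brought by the rider of position p − 1: either t_i himself or, when p = ik, the traveller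
-- t_(i−1), who has cycled at least as many of the stages before P_j as t_i and so arrives
-- there no later. For uniformity, a row is a window of k ≤ n cyclically consecutive stages,
-- and column j counts the k positions p < nk with p ≡ j (mod n), no two in the same window.

module Submission where

open import Algebra.Bundles using (CommutativeMonoid)
open import Data.Bool using (Bool; true; false; T; not; _∧_; if_then_else_)
open import Data.Bool.ListAction using (any)
open import Data.Bool.Properties using (T-≡)
open import Data.Empty using (⊥-elim)
open import Data.Fin as Fin using (Fin; toℕ; fromℕ<; inject₁)
import Data.Fin.Properties as Finₚ
open import Data.List using (List; []; _∷_; foldr; upTo; applyUpTo; tabulate; allFin)
open import Data.List.Membership.Propositional using (find; lose)
open import Data.List.Membership.Propositional.Properties using (∈-upTo⁺; ∈-upTo⁻)
open import Data.List.Relation.Unary.Any.Properties using (any⁺; any⁻)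
open import Data.Nat
open import Data.Nat.DivMod
open import Data.Nat.Divisibility using (_∣_; divides; n∣m*n; n∣m⇒m%n≡0)
open import Data.Nat.Properties
open import Data.Product using (Σ; ∃; _×_; _,_; proj₁; proj₂)
open import Data.Sum using ([_,_]′)
open import Data.Rational as ℚ using (ℚ; 0ℚ)
import Data.Rational.Properties as ℚₚ
open import Function using (_∘_; id; Equivalence)
open import Relation.Binary.PropositionalEquality hiding (J)
open import Relation.Nullary using (Dec; yes; no; contradiction)

open import Algebra.Properties.Semiring.Sum +-*-semiring
  using (sum; ∑-comm; *-distribʳ-sum; sum-cong-≗; sum-replicate-zero)
open import Algebra.Properties.Monoid.Mult ℚₚ.+-0-monoid
  using (×-homo-+) renaming (_×_ to _·_)
open import Algebra.Properties.CommutativeSemigroup +-commutativeSemigroup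
  using (xy∙z≈xz∙y; xy∙z≈y∙xz)
import Algebra.Properties.CommutativeSemigroup as CommSemigroupProperties
module ℚ+ = CommSemigroupProperties
  (CommutativeMonoid.commutativeSemigroup ℚₚ.+-0-commutativeMonoid)

open import Defs

ind : Bool → ℕ
ind b = if b then 1 else 0

count : ∀ {A : Set} → (A → Bool) → List A → ℕ
count p = foldr (λ x acc → ind (p x) + acc) 0

≡ᵇ-sym : ∀ x y → (x ≡ᵇ y) ≡ (y ≡ᵇ x)
≡ᵇ-sym zero    zero    = refl
≡ᵇ-sym zero    (suc y) = refl
≡ᵇ-sym (suc x) zero    = refl
≡ᵇ-sym (suc x) (suc y) = ≡ᵇ-sym x y

ind-∧ : ∀ x y → ind (x ∧ y) ≡ ind x * ind y
ind-∧ false y     = refl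
ind-∧ true  false = refl
ind-∧ true  true  = refl

ind-mono : ∀ {x y} → (T x → T y) → ind x ≤ ind y
ind-mono {false}          _   = z≤n
ind-mono {true}  {true}   _   = ≤-refl
ind-mono {true}  {false} x⇒y = ⊥-elim (x⇒y _)

-- Opaque, so that an equation between ∑< N f and ∑< N g determines f and g during unification.
opaque
  ∑< : ℕ → (ℕ → ℕ) → ℕ
  ∑< N f = sum {N} (f ∘ toℕ)

  syntax ∑< N (λ x → e) = ∑[ x < N ] e

  ∑<-cong : ∀ N {f g : ℕ → ℕ} → (∀ {x} → x < N → f x ≡ g x) → ∑< N f ≡ ∑< N g
  ∑<-cong N f≗g = sum-cong-≗ {N} (λ i → f≗g (Finₚ.toℕ<n i))

  ∑<-mono-≤ : ∀ N {f g : ℕ → ℕ} → (∀ {x} → x < N → f x ≤ g x) → ∑< N f ≤ ∑< N g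
  ∑<-mono-≤ zero    f≤g = z≤n
  ∑<-mono-≤ (suc N) f≤g = +-mono-≤ (f≤g z<s) (∑<-mono-≤ N (f≤g ∘ s<s))

  ∑<-zero : ∀ N → ∑[ _ < N ] 0 ≡ 0
  ∑<-zero = sum-replicate-zero

  ∑<-ones : ∀ N → ∑[ _ < N ] 1 ≡ N
  ∑<-ones zero    = refl
  ∑<-ones (suc N) = cong suc (∑<-ones N)

  ∑<-comm : ∀ A B (F : ℕ → ℕ → ℕ) → ∑[ x < A ] ∑[ y < B ] F x y ≡ ∑[ y < B ] ∑[ x < A ] F x y
  ∑<-comm A B F = ∑-comm {A} {B} (λ i j → F (toℕ i) (toℕ j))

  ∑<-distribʳ-* : ∀ N (f : ℕ → ℕ) c → ∑< N f * c ≡ ∑[ x < N ] (f x * c)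
  ∑<-distribʳ-* N f c = *-distribʳ-sum {N} c (f ∘ toℕ)

  ∑<-+ : ∀ A B (f : ℕ → ℕ) → ∑< (A + B) f ≡ ∑< A f + ∑[ x < B ] f (A + x)
  ∑<-+ zero    B f = refl
  ∑<-+ (suc A) B f = trans (cong (f 0 +_) (∑<-+ A B (f ∘ suc))) (sym (+-assoc (f 0) _ _))

  ∑<-blocks : ∀ N K (F : ℕ → ℕ) → ∑[ i < N ] ∑[ a < K ] F (i * K + a) ≡ ∑< (N * K) F
  ∑<-blocks zero    K F = refl
  ∑<-blocks (suc N) K F = begin
      ∑< K F + ∑[ i < N ] ∑[ a < K ] F (K + i * K + a)
    ≡⟨ cong (∑< K F +_) (∑<-cong N λ {i} _ → ∑<-cong K λ {a} _ → cong F (+-assoc K (i * K) a)) ⟩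
      ∑< K F + ∑[ i < N ] ∑[ a < K ] F (K + (i * K + a))
    ≡⟨ cong (∑< K F +_) (∑<-blocks N K (λ x → F (K + x))) ⟩
      ∑< K F + ∑[ x < N * K ] F (K + x)
    ≡⟨ ∑<-+ K (N * K) F ⟨
      ∑< (K + N * K) F
    ∎
    where open ≡-Reasoning

  ∑<-δ : ∀ N (f : ℕ → ℕ) {x} → x < N → ∑[ s < N ] (ind (s ≡ᵇ x) * f s) ≡ f x
  ∑<-δ (suc N) f {zero}  _         =
    trans (cong₂ _+_ (*-identityˡ (f 0)) (∑<-zero N)) (+-identityʳ (f 0))
  ∑<-δ (suc N) f {suc x} (s<s x<N) = ∑<-δ N (f ∘ suc) x<N

  ind-any : ∀ K (p : ℕ → Bool) →
    (∀ {a b} → a < K → b < K → T (p a) → T (p b) → a ≡ b) →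
    ind (any p (upTo K)) ≡ ∑[ a < K ] ind (p a)
  ind-any K p = go K id
    where
    go : ∀ K (f : ℕ → ℕ) → (∀ {a b} → a < K → b < K → T (p (f a)) → T (p (f b)) → a ≡ b) →
         ind (any p (applyUpTo f K)) ≡ ∑[ a < K ] ind (p (f a))
    go zero    f _    = refl
    go (suc K) f once with p (f 0) in eq
    ... | true  = cong suc (sym (trans (∑<-cong K none) (∑<-zero K)))
      where
      none : ∀ {a} → a < K → ind (p (f (suc a))) ≡ 0
      none {a} a<K with p (f (suc a)) in eq′
      ... | false = refl
      ... | true with () ← once z<s (s<s a<K) (subst T (sym eq) _) (subst T (sym eq′) _)
    ... | false = go K (f ∘ suc) (λ a<K b<K pa pb → suc-injective (once (s<s a<K) (s<s b<K) pa pb))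

  ones-∑ : ∀ {N} (P : ℕ → Bool) → ones {N} (P ∘ toℕ) ≡ ∑[ x < N ] ind (P x)
  ones-∑ {N} P = count-tabulate {N} id
    where
    count-tabulate : ∀ {M N} (e : Fin N → Fin M) → count (P ∘ toℕ) (tabulate e) ≡ sum (λ i → ind (P (toℕ (e i))))
    count-tabulate {N = zero}  e = refl
    count-tabulate {N = suc N} e = cong (ind (P (toℕ (e Fin.zero))) +_) (count-tabulate (e ∘ Fin.suc))


[r+q*n]%n≡r : ∀ {n r} .{{_ : NonZero n}} q → r < n → (r + q * n) % n ≡ r
[r+q*n]%n≡r {n} {r} q r<n = trans ([m+kn]%n≡m%n r q n) (m<n⇒m%n≡m r<n)

[r+q*n]/n≡q : ∀ {n r} .{{_ : NonZero n}} q → r < n → (r + q * n) / n ≡ q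
[r+q*n]/n≡q {n} {r} q r<n = begin
  (r + q * n) / n    ≡⟨ +-distrib-/-∣ʳ r (n∣m*n q) ⟩
  r / n + q * n / n  ≡⟨ cong₂ _+_ (m<n⇒m/n≡0 r<n) (m*n/n≡m q n) ⟩
  q                  ∎
  where open ≡-Reasoning

%-/-injective : ∀ {n x y} .{{_ : NonZero n}} → x % n ≡ y % n → x / n ≡ y / n → x ≡ y
%-/-injective {n} {x} {y} %≡ /≡ = begin
  x                  ≡⟨ m≡m%n+[m/n]*n x n ⟩
  x % n + x / n * n  ≡⟨ cong₂ (λ r q → r + q * n) %≡ /≡ ⟩
  y % n + y / n * n  ≡⟨ m≡m%n+[m/n]*n y n ⟨
  y                  ∎
  where open ≡-Reasoning

%-/-pred : ∀ {n} .{{_ : NonZero n}} Q {j} → suc Q % n ≡ suc j → Q % n ≡ j × Q / n ≡ suc Q / n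
%-/-pred {n} Q {j} eq =
  trans (cong (_% n) Q≡) ([r+q*n]%n≡r t j<n) , trans (cong (_/ n) Q≡) ([r+q*n]/n≡q t j<n)
  where
  t = suc Q / n
  Q≡ : Q ≡ j + t * n
  Q≡ = suc-injective (trans (m≡m%n+[m/n]*n (suc Q) n) (cong (_+ t * n) eq))
  j<n : j < n
  j<n = <-trans (n<1+n j) (subst (_< n) eq (m%n<n (suc Q) n))

%-≡⇒∣ : ∀ {n} .{{_ : NonZero n}} x d → (x + d) % n ≡ x % n → n ∣ d
%-≡⇒∣ {n} x d eq = divides ((x + d) / n ∸ x / n) (begin
  d                                              ≡⟨ m+n∸m≡n x d ⟨
  x + d ∸ x                                      ≡⟨ cong₂ _∸_ (m≡m%n+[m/n]*n (x + d) n) (m≡m%n+[m/n]*n x n) ⟩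
  (x + d) % n + (x + d) / n * n ∸ (x % n + x / n * n)
    ≡⟨ cong (λ r → r + (x + d) / n * n ∸ (x % n + x / n * n)) eq ⟩
  x % n + (x + d) / n * n ∸ (x % n + x / n * n)  ≡⟨ [m+n]∸[m+o]≡n∸o (x % n) _ _ ⟩
  (x + d) / n * n ∸ x / n * n                    ≡⟨ *-distribʳ-∸ n ((x + d) / n) (x / n) ⟨
  ((x + d) / n ∸ x / n) * n                      ∎)
  where open ≡-Reasoning

+-%-injectiveʳ : ∀ {n} .{{_ : NonZero n}} c {a b} → a < n → b < n → (c + a) % n ≡ (c + b) % n → a ≡ b
+-%-injectiveʳ {n} c {a} {b} a<n b<n eq =
  [ (λ a≤b → ordered a≤b b<n eq) , (λ b≤a → sym (ordered b≤a a<n (sym eq))) ]′ (≤-total a b)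
  where
  ordered : ∀ {a b} → a ≤ b → b < n → (c + a) % n ≡ (c + b) % n → a ≡ b
  ordered {a} {b} a≤b b<n eq = ≤-antisym a≤b (m∸n≡0⇒m≤n gap≡0)
    where
    gap<n : b ∸ a < n
    gap<n = ≤-<-trans (m∸n≤m b a) b<n
    shifted : (c + a + (b ∸ a)) % n ≡ (c + a) % n
    shifted = trans (cong (_% n) (trans (+-assoc c a _) (cong (c +_) (m+[n∸m]≡n a≤b)))) (sym eq)
    gap≡0 : b ∸ a ≡ 0
    gap≡0 = trans (sym (m<n⇒m%n≡m gap<n)) (n∣m⇒m%n≡0 _ n (%-≡⇒∣ (c + a) (b ∸ a) shifted))

quotient-unique : ∀ {k i i′ a a′} → a < k → a′ < k → i * k + a ≡ i′ * k + a′ → i ≡ i′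
quotient-unique {i = zero}  {zero}   _   _    _  = refl
quotient-unique {k} {zero} {suc i′} {a′ = a′} a<k _ eq =
  contradiction (subst (k ≤_) (sym eq) (≤-trans (m≤m+n k (i′ * k)) (m≤m+n _ a′))) (<⇒≱ a<k)
quotient-unique {i = suc i} {zero} a<k a′<k eq = sym (quotient-unique a′<k a<k (sym eq))
quotient-unique {k} {suc i} {suc i′} a<k a′<k eq =
  cong suc (quotient-unique a<k a′<k (+-cancelˡ-≡ k _ _ (trans (sym (+-assoc k _ _)) (trans eq (+-assoc k _ _)))))

-- With J = (k + c) mod n: if J + a < n nothing wraps around, otherwise (c + a) mod n = J + a − k < J.
[k+c+a]%n<[k+c]%n⇒[c+a]%n<[k+c]%n : ∀ {n} .{{_ : NonZero n}} c {k a} → k ≤ n → a < k →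
  (k + c + a) % n < (k + c) % n → (c + a) % n < (k + c) % n
[k+c+a]%n<[k+c]%n⇒[c+a]%n<[k+c]%n {n} c {k} {a} k≤n a<k wrapped = go (J + a <? n)
  where
  J = (k + c) % n
  t = (k + c) / n
  k+c≡ : k + c ≡ J + t * n
  k+c≡ = m≡m%n+[m/n]*n (k + c) n
  k+c+a≡ : k + c + a ≡ J + a + t * n
  k+c+a≡ = trans (cong (_+ a) k+c≡) (xy∙z≈xz∙y J (t * n) a)
  go : Dec (J + a < n) → (c + a) % n < J
  go (yes J+a<n) = contradiction (subst (_< J) no-wrap wrapped) (m+n≮m J a)
    where
    no-wrap : (k + c + a) % n ≡ J + a
    no-wrap = trans (cong (_% n) k+c+a≡) ([r+q*n]%n≡r t J+a<n)
  go (no J+a≮n) = subst (_< J) (sym c+a%n≡f) f<J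
    where
    f = J + a ∸ k
    f+k≡ : f + k ≡ J + a
    f+k≡ = m∸n+n≡m (≤-trans k≤n (≮⇒≥ J+a≮n))
    c+a≡ : c + a ≡ f + t * n
    c+a≡ = +-cancelˡ-≡ k _ _ (begin
      k + (c + a)    ≡⟨ +-assoc k c a ⟨
      k + c + a      ≡⟨ k+c+a≡ ⟩
      J + a + t * n  ≡⟨ cong (_+ t * n) f+k≡ ⟨
      f + k + t * n  ≡⟨ xy∙z≈y∙xz f k (t * n) ⟩
      k + (f + t * n) ∎)
      where open ≡-Reasoning
    f<J : f < J
    f<J = +-cancelʳ-< k f J (subst (_< J + k) (sym f+k≡) (+-monoʳ-< J a<k))
    c+a%n≡f : (c + a) % n ≡ f
    c+a%n≡f = trans (cong (_% n) c+a≡) ([r+q*n]%n≡r t (<-trans f<J (m%n<n (k + c) n)))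

cycledBefore : ∀ {n} → Matrix n → Fin n → ℕ → ℕ
cycledBefore M i J = ones (λ s → M i s ∧ (toℕ s <ᵇ J))

walkedBefore : ∀ {n} → Matrix n → Fin n → ℕ → ℕ
walkedBefore M i J = ones (λ s → not (M i s) ∧ (toℕ s <ᵇ J))

foldr-stageTimes : ∀ {A : Set} (a b : ℚ) (g h : A → Bool) xs →
  foldr (λ s acc → (if h s then (if g s then b else a) else 0ℚ) ℚ.+ acc) 0ℚ xs
    ≡ count (λ s → g s ∧ h s) xs · b ℚ.+ count (λ s → not (g s) ∧ h s) xs · a
foldr-stageTimes a b g h []       = sym (ℚₚ.+-identityʳ 0ℚ)
foldr-stageTimes a b g h (x ∷ xs) with g x | h x | foldr-stageTimes a b g h xs
... | true  | false | ih = trans (ℚₚ.+-identityˡ _) ih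
... | false | false | ih = trans (ℚₚ.+-identityˡ _) ih
... | true  | true  | ih = trans (cong (b ℚ.+_) ih) (sym (ℚₚ.+-assoc b _ _))
... | false | true  | ih = trans (cong (a ℚ.+_) ih) (ℚ+.x∙yz≈y∙xz a (count (λ s → g s ∧ h s) xs · b) _)

count-∧-not : ∀ {A : Set} (g h : A → Bool) xs →
  count (λ s → g s ∧ h s) xs + count (λ s → not (g s) ∧ h s) xs ≡ count h xs
count-∧-not g h []       = refl
count-∧-not g h (x ∷ xs) with g x | h x | count-∧-not g h xs
... | true  | false | ih = ih
... | false | false | ih = ih
... | true  | true  | ih = cong suc ih
... | false | true  | ih = trans (+-suc _ _) (cong suc ih)

arrival≡ : ∀ {n} (a b : ℚ) (M : Matrix n) i J →
  arrival a b M i J ≡ cycledBefore M i J · b ℚ.+ walkedBefore M i J · a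
arrival≡ {n} a b M i J = foldr-stageTimes a b (M i) (λ s → toℕ s <ᵇ J) (allFin n)

cycled+walked : ∀ {n} (M : Matrix n) i J → cycledBefore M i J + walkedBefore M i J ≡ ones {n} (λ s → toℕ s <ᵇ J)
cycled+walked {n} M i J = count-∧-not (M i) (λ s → toℕ s <ᵇ J) (allFin n)

·-monoʳ-≤ : ∀ c {x y} → x ℚ.≤ y → c · x ℚ.≤ c · y
·-monoʳ-≤ zero    x≤y = ℚₚ.≤-refl
·-monoʳ-≤ (suc c) x≤y = ℚₚ.+-mono-≤ x≤y (·-monoʳ-≤ c x≤y)

·-exchange : ∀ {a b} → b ℚ.≤ a → ∀ c e d → (c + e) · b ℚ.+ d · a ℚ.≤ c · b ℚ.+ (e + d) · a
·-exchange {a} {b} b≤a c e d = begin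
  (c + e) · b ℚ.+ d · a      ≡⟨ cong (ℚ._+ d · a) (×-homo-+ b c e) ⟩
  (c · b ℚ.+ e · b) ℚ.+ d · a ≡⟨ ℚₚ.+-assoc (c · b) (e · b) (d · a) ⟩
  c · b ℚ.+ (e · b ℚ.+ d · a) ≤⟨ ℚₚ.+-monoʳ-≤ (c · b) (ℚₚ.+-monoˡ-≤ (d · a) (·-monoʳ-≤ e b≤a)) ⟩
  c · b ℚ.+ (e · a ℚ.+ d · a) ≡⟨ cong (c · b ℚ.+_) (×-homo-+ a e d) ⟨
  c · b ℚ.+ (e + d) · a      ∎
  where open ℚₚ.≤-Reasoning

arrival-mono : ∀ {n a b} (M : Matrix n) → b ℚ.≤ a → ∀ {i i′} J →
  cycledBefore M i J ≤ cycledBefore M i′ J → arrival a b M i′ J ℚ.≤ arrival a b M i J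
arrival-mono {n} {a} {b} M b≤a {i} {i′} J c≤c′ = begin
  arrival a b M i′ J          ≡⟨ arrival≡ a b M i′ J ⟩
  c′ · b ℚ.+ d′ · a           ≡⟨ cong (λ x → x · b ℚ.+ d′ · a) (m+[n∸m]≡n c≤c′) ⟨
  (c + e) · b ℚ.+ d′ · a      ≤⟨ ·-exchange b≤a c e d′ ⟩
  c · b ℚ.+ (e + d′) · a      ≡⟨ cong (λ x → c · b ℚ.+ x · a) d≡e+d′ ⟨
  c · b ℚ.+ d · a             ≡⟨ arrival≡ a b M i J ⟨
  arrival a b M i J           ∎
  where
  open ℚₚ.≤-Reasoning
  c  = cycledBefore M i J
  d  = walkedBefore M i J
  c′ = cycledBefore M i′ J
  d′ = walkedBefore M i′ J
  e  = c′ ∸ c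
  d≡e+d′ : d ≡ e + d′
  d≡e+d′ = +-cancelˡ-≡ c _ _ (trans (trans (cycled+walked M i J) (sym (cycled+walked M i′ J)))
                                      (trans (cong (_+ d′) (sym (m+[n∸m]≡n c≤c′))) (+-assoc c e d′)))

module Cyclic (m k : ℕ) (k≤n : k ≤ suc m) where

  n : ℕ
  n = suc m

  M : Matrix n
  M = cyclicMatrix n k

  inWindow : ℕ → ℕ → Bool
  inWindow c s = any (λ a → s ≡ᵇ (c + a) % n) (upTo k)

  ind-inWindow : ∀ c s → ind (inWindow c s) ≡ ∑[ a < k ] ind (s ≡ᵇ (c + a) % n)
  ind-inWindow c s = ind-any k _ λ a<k b<k sa sb →
    +-%-injectiveʳ c (<-≤-trans a<k k≤n) (<-≤-trans b<k k≤n) (trans (sym (≡ᵇ⇒≡ s _ sa)) (≡ᵇ⇒≡ s _ sb))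

  ∑-inWindow : ∀ c (g : ℕ → ℕ) → ∑[ s < n ] (ind (inWindow c s) * g s) ≡ ∑[ a < k ] g ((c + a) % n)
  ∑-inWindow c g = begin
    ∑[ s < n ] (ind (inWindow c s) * g s)
      ≡⟨ ∑<-cong n (λ {s} _ → trans (cong (_* g s) (ind-inWindow c s)) (∑<-distribʳ-* k _ (g s))) ⟩
    ∑[ s < n ] ∑[ a < k ] (ind (s ≡ᵇ (c + a) % n) * g s)
      ≡⟨ ∑<-comm n k _ ⟩
    ∑[ a < k ] ∑[ s < n ] (ind (s ≡ᵇ (c + a) % n) * g s)
      ≡⟨ ∑<-cong k (λ {a} _ → ∑<-δ n g (m%n<n (c + a) n)) ⟩
    ∑[ a < k ] g ((c + a) % n)
      ∎
    where open ≡-Reasoning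

  row-ones : ∀ i → ones (M i) ≡ k
  row-ones i = begin
    ones (M i)                           ≡⟨ ones-∑ (inWindow c) ⟩
    ∑[ s < n ] ind (inWindow c s)        ≡⟨ ∑<-cong n (λ _ → sym (*-identityʳ _)) ⟩
    ∑[ s < n ] (ind (inWindow c s) * 1)  ≡⟨ ∑-inWindow c (λ _ → 1) ⟩
    ∑[ _ < k ] 1                         ≡⟨ ∑<-ones k ⟩
    k                                    ∎
    where
    c = toℕ i * k
    open ≡-Reasoning

  column-ones : ∀ j → ones (λ i → M i j) ≡ k
  column-ones j = begin
    ones (λ i → M i j)                         ≡⟨ ones-∑ (λ x → inWindow (x * k) (toℕ j)) ⟩
    ∑[ i < n ] ind (inWindow (i * k) (toℕ j))  ≡⟨ ∑<-cong n (λ {i} _ → ind-inWindow (i * k) (toℕ j)) ⟩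
    ∑[ i < n ] ∑[ a < k ] F (i * k + a)        ≡⟨ ∑<-blocks n k F ⟩
    ∑< (n * k) F                               ≡⟨ cong (λ N → ∑< N F) (*-comm n k) ⟩
    ∑< (k * n) F                               ≡⟨ ∑<-blocks k n F ⟨
    ∑[ q < k ] ∑[ r < n ] F (q * n + r)        ≡⟨ ∑<-cong k (λ {q} _ → one-per-lap q) ⟩
    ∑[ _ < k ] 1                               ≡⟨ ∑<-ones k ⟩
    k                                          ∎
    where
    open ≡-Reasoning
    F : ℕ → ℕ
    F p = ind (toℕ j ≡ᵇ p % n)
    one-per-lap : ∀ q → ∑[ r < n ] F (q * n + r) ≡ 1
    one-per-lap q = trans (∑<-cong n F≡δ) (∑<-δ n (λ _ → 1) (Finₚ.toℕ<n j))
      where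
      F≡δ : ∀ {r} → r < n → F (q * n + r) ≡ ind (r ≡ᵇ toℕ j) * 1
      F≡δ {r} r<n = begin
        ind (toℕ j ≡ᵇ (q * n + r) % n)  ≡⟨ cong (λ x → ind (toℕ j ≡ᵇ x)) (%-remove-+ˡ r (n∣m*n q)) ⟩
        ind (toℕ j ≡ᵇ r % n)            ≡⟨ cong (λ x → ind (toℕ j ≡ᵇ x)) (m<n⇒m%n≡m r<n) ⟩
        ind (toℕ j ≡ᵇ r)                ≡⟨ cong ind (≡ᵇ-sym (toℕ j) r) ⟩
        ind (r ≡ᵇ toℕ j)                ≡⟨ *-identityʳ _ ⟨
        ind (r ≡ᵇ toℕ j) * 1            ∎

  uniform : Uniform k M
  uniform = row-ones , column-ones

  record Ride (i j : Fin n) : Set where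
    constructor ride
    field
      offset   : ℕ
      offset<k : offset < k
      stage≡   : toℕ j ≡ (toℕ i * k + offset) % n

    position : ℕ
    position = toℕ i * k + offset

  open Ride

  M⇒Ride : ∀ {i j} → M i j ≡ true → Ride i j
  M⇒Ride {i} {j} Mij with find (any⁻ _ (upTo k) (Equivalence.from T-≡ Mij))
  ... | a , a∈ , j≡ = ride a (∈-upTo⁻ a∈) (≡ᵇ⇒≡ (toℕ j) _ j≡)

  Ride⇒M : ∀ {i j} → Ride i j → M i j ≡ true
  Ride⇒M {i} {j} (ride a a<k j≡) =
    Equivalence.to T-≡ (any⁺ _ (lose (∈-upTo⁺ a<k) (≡⇒≡ᵇ (toℕ j) _ j≡)))

  position-unique : ∀ {i j} (r r′ : Ride i j) → position r ≡ position r′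
  position-unique {i} r r′ = cong (toℕ i * k +_)
    (+-%-injectiveʳ (toℕ i * k) (<-≤-trans (offset<k r) k≤n) (<-≤-trans (offset<k r′) k≤n)
                    (trans (sym (stage≡ r)) (stage≡ r′)))

  position<k*n : ∀ {i j} (r : Ride i j) → position r < k * n
  position<k*n {i} r = begin-strict
    toℕ i * k + offset r  <⟨ +-monoʳ-< (toℕ i * k) (offset<k r) ⟩
    toℕ i * k + k         ≡⟨ +-comm _ k ⟩
    suc (toℕ i) * k       ≤⟨ *-monoˡ-≤ k (Finₚ.toℕ<n i) ⟩
    n * k                 ≡⟨ *-comm n k ⟩
    k * n                 ∎
    where open ≤-Reasoning

  bicycle : ∀ {i j} → Ride i j → Fin k
  bicycle r = fromℕ< (m<n*o⇒m/o<n (position<k*n r))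

  bicycle-≡ : ∀ {i j i′ j′} (r : Ride i j) (r′ : Ride i′ j′) →
    position r / n ≡ position r′ / n → bicycle r ≡ bicycle r′
  bicycle-≡ r r′ eq = Finₚ.toℕ-injective
    (trans (Finₚ.toℕ-fromℕ< _) (trans eq (sym (Finₚ.toℕ-fromℕ< _))))

  bicycle-injective : ∀ {i i′ j} (r : Ride i j) (r′ : Ride i′ j) → bicycle r ≡ bicycle r′ → i ≡ i′
  bicycle-injective r r′ eq =
    Finₚ.toℕ-injective (quotient-unique (offset<k r) (offset<k r′) same-position)
    where
    same-position : position r ≡ position r′
    same-position = %-/-injective (trans (sym (stage≡ r)) (stage≡ r′))
      (trans (sym (Finₚ.toℕ-fromℕ< _)) (trans (cong toℕ eq) (Finₚ.toℕ-fromℕ< _)))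

  cycledBefore-window : ∀ i J → cycledBefore M i J ≡ ∑[ a < k ] ind ((toℕ i * k + a) % n <ᵇ J)
  cycledBefore-window i J = begin
    cycledBefore M i J                              ≡⟨ ones-∑ (λ s → inWindow c s ∧ (s <ᵇ J)) ⟩
    ∑[ s < n ] ind (inWindow c s ∧ (s <ᵇ J))        ≡⟨ ∑<-cong n (λ {s} _ → ind-∧ (inWindow c s) (s <ᵇ J)) ⟩
    ∑[ s < n ] (ind (inWindow c s) * ind (s <ᵇ J))  ≡⟨ ∑-inWindow c (λ s → ind (s <ᵇ J)) ⟩
    ∑[ a < k ] ind ((c + a) % n <ᵇ J)               ∎
    where
    c = toℕ i * k
    open ≡-Reasoning

  previous-traveller-cycles-more : ∀ (i₀ : Fin m) {J} → J ≡ (toℕ (Fin.suc i₀) * k) % n →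
    cycledBefore M (Fin.suc i₀) J ≤ cycledBefore M (inject₁ i₀) J
  previous-traveller-cycles-more i₀ {J} refl = begin
    cycledBefore M (Fin.suc i₀) J                         ≡⟨ cycledBefore-window (Fin.suc i₀) J ⟩
    ∑[ a < k ] ind ((k + c + a) % n <ᵇ J)                 ≤⟨ ∑<-mono-≤ k earlier ⟩
    ∑[ a < k ] ind ((c + a) % n <ᵇ J)                     ≡⟨ cong (λ x → ∑[ a < k ] ind ((x * k + a) % n <ᵇ J)) (Finₚ.toℕ-inject₁ i₀) ⟨
    ∑[ a < k ] ind ((toℕ (inject₁ i₀) * k + a) % n <ᵇ J)  ≡⟨ cycledBefore-window (inject₁ i₀) J ⟨
    cycledBefore M (inject₁ i₀) J                         ∎
    where
    open ≤-Reasoning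
    c = toℕ i₀ * k
    earlier : ∀ {a} → a < k → ind ((k + c + a) % n <ᵇ J) ≤ ind ((c + a) % n <ᵇ J)
    earlier a<k = ind-mono λ lt → <⇒<ᵇ ([k+c+a]%n<[k+c]%n⇒[c+a]%n<[k+c]%n c k≤n a<k (<ᵇ⇒< _ _ lt))

  step-back : ∀ {i i′ j j′ a′} → toℕ j ≡ suc (toℕ j′) → (r : Ride i j) → a′ < k →
    suc (toℕ i′ * k + a′) ≡ position r → Σ (Ride i′ j′) λ r′ → position r′ / n ≡ position r / n
  step-back {i′ = i′} {a′ = a′} j≡ r a′<k suc≡ =
    ride a′ a′<k (sym (proj₁ previous)) , trans (proj₂ previous) (cong (_/ n) suc≡)
    where
    previous = %-/-pred (toℕ i′ * k + a′) (trans (cong (_% n) suc≡) (trans (sym (stage≡ r)) j≡))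

  previous-ride : ∀ {i j j′} → toℕ j ≡ suc (toℕ j′) → (r : Ride i j) →
    ∃ λ i′ → Σ (Ride i′ j′) λ r′ →
      position r′ / n ≡ position r / n × cycledBefore M i (toℕ j) ≤ cycledBefore M i′ (toℕ j)
  previous-ride {i} j≡ r@(ride (suc a) a<k _) =
    let r′ , same-bicycle = step-back j≡ r (<-trans (n<1+n a) a<k) (sym (+-suc (toℕ i * k) a))
    in i , r′ , same-bicycle , ≤-refl
  previous-ride {Fin.zero} j≡ (ride zero _ stage) = contradiction (trans (sym stage) j≡) 0≢1+n
  previous-ride {Fin.suc i₀} j≡ r@(ride zero 0<k stage) =
    let r′ , same-bicycle = step-back j≡ r k₀<k k₀-step
    in inject₁ i₀ , r′ , same-bicycle ,
       previous-traveller-cycles-more i₀ (trans stage (cong (_% n) (+-identityʳ (k + c))))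
    where
    k₀ = pred k
    suc-k₀ : suc k₀ ≡ k
    suc-k₀ = suc-pred k {{>-nonZero 0<k}}
    k₀<k : k₀ < k
    k₀<k = subst (k₀ <_) suc-k₀ (n<1+n k₀)
    c = toℕ i₀ * k
    k₀-step : suc (toℕ (inject₁ i₀) * k + k₀) ≡ k + c + 0
    k₀-step = begin
      suc (toℕ (inject₁ i₀) * k + k₀)  ≡⟨ cong (λ x → suc (x * k + k₀)) (Finₚ.toℕ-inject₁ i₀) ⟩
      suc (c + k₀)                     ≡⟨ +-suc c k₀ ⟨
      c + suc k₀                       ≡⟨ cong (c +_) suc-k₀ ⟩
      c + k                            ≡⟨ +-comm c k ⟩
      k + c                            ≡⟨ +-identityʳ (k + c) ⟨
      k + c + 0                        ∎
      where open ≡-Reasoning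

  bike : ∀ i j → M i j ≡ true → Fin k
  bike i j p = bicycle (M⇒Ride {i} {j} p)

  handover : ∀ {a b} → b ℚ.≤ a → ∀ i j j′ → toℕ j ≡ suc (toℕ j′) → (p : M i j ≡ true) →
    ∃ λ i′ → Σ (M i′ j′ ≡ true) λ p′ →
      bike i′ j′ p′ ≡ bike i j p × arrival a b M i′ (toℕ j) ℚ.≤ arrival a b M i (toℕ j)
  handover b≤a i j j′ j≡ p =
    let i′ , r′ , same-bicycle , cycles-more = previous-ride {j′ = j′} j≡ (M⇒Ride {i} {j} p)
    in i′ , Ride⇒M r′ ,
       bicycle-≡ (M⇒Ride {i′} {j′} (Ride⇒M r′)) (M⇒Ride {i} {j} p)
                 (trans (cong (_/ n) (position-unique (M⇒Ride (Ride⇒M r′)) r′)) same-bicycle) ,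
       arrival-mono M b≤a {i} {i′} (toℕ j) cycles-more

  executable : ∀ {a b} → b ℚ.≤ a → NoWaitExecutable a b k M
  executable b≤a =
    bike , (λ i i′ j p p′ → bicycle-injective (M⇒Ride {i} {j} p) (M⇒Ride {i′} {j} p′)) , handover b≤a

theorem4p2 : (m k : ℕ) → k ≤ suc m → (a b : ℚ) → 0ℚ ℚ.< b → b ℚ.< a →
    Uniform k (cyclicMatrix (suc m) k) × Optimal a b (cyclicMatrix (suc m) k)
theorem4p2 m k k≤n a b _ b<a = uniform , k , uniform , executable (ℚₚ.<⇒≤ b<a)
  where open Cyclic m k k≤n
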